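{- Let $\mathcal{B}(3)=\{(c,b,a)\in\mathbb{Z}^3: 0\le c<b<a\}$. Call $t_0=(0,b,a)\in\mathcal{B}(3)$ initial if $b$ is odd and $a-b\not\equiv 2\pmod 3$; set $v_{t_0}=(0,1,2)$ if $a-b\equiv 1\pmod 3$ and $v_{t_0}=(0,2,1)$ if $a-b\equiv 0\pmod 3$. For an initial $t_0$ let \[ P(t_0,v_{t_0})=\Big\{\,t_0+\Big\lfloor \tfrac{1}{3}\big(v_{t_0}+k(1,1,1)\big)\Big\rfloor \;:\; k\in\mathbb{Z}_{\ge 0}\Big\}, \] where the floor is taken entrywise. Then the sets $P(t_0,v_{t_0})$, for $t_0$ ranging over all initial tableaux, are pairwise disjoint subsets of $\mathcal{B}(3)$ whose union is $\mathcal{B}(3)$.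
   Context: Elements $(c,b,a)$ of $\mathcal{B}(3)$ encode column tableaux (strictly increasing triples) indexing a basis of $\Lambda^3\mathrm{Sym}^r\mathbb{C}^2$ for $a\le r$. -}

module Defs where

open import Data.Nat using (ℕ; zero; suc; _+_; _∸_; _<_)
open import Data.Nat.DivMod using (_/_; _%_)
open import Data.Product using (_×_; _,_; ∃-syntax)
open import Relation.Binary.PropositionalEquality using (_≡_; _≢_)

-- A triple (c , b , a) of integers; since 0 ≤ c < b < a all entries are
-- natural numbers, so we use ℕ.
Triple : Set
Triple = ℕ × ℕ × ℕ

B3 : Triple → Set
B3 (c , b , a) = c < b × b < a

Initial : Triple → Set
Initial t@(c , b , a) = B3 t × c ≡ 0 × b % 2 ≡ 1 × (a ∸ b) % 3 ≢ 2

-- v_{t₀}: (0,1,2) if a - b ≡ 1 (mod 3), (0,2,1) if a - b ≡ 0 (mod 3)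
-- (only used for initial t₀, where a - b mod 3 ∈ {0,1})
vec : Triple → Triple
vec (c , b , a) with (a ∸ b) % 3
... | 1 = (0 , 1 , 2)
... | _ = (0 , 2 , 1)

step : Triple → ℕ → Triple
step t@(c , b , a) k with vec t
... | (v₀ , v₁ , v₂) = (c + (v₀ + k) / 3 , b + (v₁ + k) / 3 , a + (v₂ + k) / 3)

InP : Triple → Triple → Set
InP t₀ t = ∃[ k ] step t₀ k ≡ t

-- A tableau (c , b , a) ∈ 𝓑(3) is the shift by c of the base tableau (0 , b − c , a − c), and
-- base tableaux are coordinatised by b = 1 + ε + 2m and a − b = 1 + δ + 3j with ε < 2, δ < 3.
-- For k = r + 3q the k-th point of P(t₀, v_{t₀}) is the shift by q of the r-th one, and for
-- r < 3 the floors ⌊(v + r)/3⌋ raise b and a by at most 1.  The initial tableaux are the base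
-- tableaux with ε = 0 and δ ∈ {0, 2}; the three base points of such a tableau keep its (m , j),
-- and the two initial tableaux with given (m , j) share out the six residue pairs (ε , δ)
-- between them.  So t₀ can be read off any point of P(t₀, v_{t₀}), which gives disjointness.
module Submission where

open import Defs
open import Data.Product using (_×_; _,_; ∃-syntax; proj₁; proj₂; map₂)
open import Relation.Binary.PropositionalEquality using (_≡_; _≢_)
open import Relation.Nullary using (¬_)

open import Algebra.Properties.CommutativeSemigroup using (x∙yz≈z∙xy)
open import Data.Empty using (⊥-elim)
open import Data.Fin using (Fin; toℕ) renaming (zero to 0F; suc to sucF)
open import Data.Fin.Properties using (toℕ-injective; toℕ-fromℕ<; toℕ<n)
open import Data.Nat using (ℕ; suc; _+_; _*_; _∸_; z<s; NonZero)
open import Data.Nat.DivMod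
  using (_/_; _%_; _div_; _mod_; _divMod_; result; [m+kn]%n≡m%n; +-distrib-/-∣ʳ; m*n/n≡m;
         m<n⇒m/n≡0; m<n⇒m%n≡m)
open import Data.Nat.Divisibility using (divides)
open import Data.Nat.Properties
  using (+-assoc; +-comm; +-identityʳ; +-suc; +-monoʳ-<; +-commutativeSemigroup; m<m+n;
         m+n∸m≡n; [m+n]∸[m+o]≡n∸o; m≤n⇒∃[o]m+o≡n; m+n≡0⇒m≡0)
open import Function using (_∘_)
open import Relation.Binary.PropositionalEquality
  using (refl; sym; trans; cong; cong₂; subst; module ≡-Reasoning)

open ≡-Reasoning

[m+kn]/n≡m/n+k : ∀ m k n .{{_ : NonZero n}} → (m + k * n) / n ≡ m / n + k
[m+kn]/n≡m/n+k m k n = begin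
  (m + k * n) / n   ≡⟨ +-distrib-/-∣ʳ m (divides k refl) ⟩
  m / n + k * n / n ≡⟨ cong (m / n +_) (m*n/n≡m k n) ⟩
  m / n + k         ∎

[i+kn]div≡k : ∀ {n} .{{_ : NonZero n}} (i : Fin n) k → (toℕ i + k * n) div n ≡ k
[i+kn]div≡k {n} i k = trans ([m+kn]/n≡m/n+k (toℕ i) k n) (cong (_+ k) (m<n⇒m/n≡0 (toℕ<n i)))

[i+kn]mod≡i : ∀ {n} .{{_ : NonZero n}} (i : Fin n) k → (toℕ i + k * n) mod n ≡ i
[i+kn]mod≡i {n} i k = toℕ-injective (begin
  toℕ ((toℕ i + k * n) mod n) ≡⟨ toℕ-fromℕ< _ ⟩
  (toℕ i + k * n) % n         ≡⟨ [m+kn]%n≡m%n (toℕ i) k n ⟩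
  toℕ i % n                   ≡⟨ m<n⇒m%n≡m (toℕ<n i) ⟩
  toℕ i                       ∎)

shift : ℕ → Triple → Triple
shift q (c , b , a) = (q + c , q + b , q + a)

B3-shift : ∀ q {t} → B3 t → B3 (shift q t)
B3-shift q (c<b , b<a) = +-monoʳ-< q c<b , +-monoʳ-< q b<a

step-shift : ∀ t r q → step t (r + q * 3) ≡ shift q (step t r)
step-shift (c , b , a) r q with vec (c , b , a)
... | (v₀ , v₁ , v₂) = cong₂ _,_ (entry c v₀) (cong₂ _,_ (entry b v₁) (entry a v₂))
  where
  entry : ∀ x v → x + (v + (r + q * 3)) / 3 ≡ q + (x + (v + r) / 3)
  entry x v = begin
    x + (v + (r + q * 3)) / 3 ≡⟨ cong (λ n → x + n / 3) (sym (+-assoc v r (q * 3))) ⟩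
    x + (v + r + q * 3) / 3   ≡⟨ cong (x +_) ([m+kn]/n≡m/n+k (v + r) q 3) ⟩
    x + ((v + r) / 3 + q)     ≡⟨ x∙yz≈z∙xy +-commutativeSemigroup x ((v + r) / 3) q ⟩
    q + (x + (v + r) / 3)     ∎

gaps : Triple → ℕ × ℕ
gaps (c , b , a) = b ∸ c , a ∸ b

gaps-shift : ∀ q t → gaps (shift q t) ≡ gaps t
gaps-shift q (c , b , a) = cong₂ _,_ ([m+n]∸[m+o]≡n∸o q b c) ([m+n]∸[m+o]≡n∸o q a b)

baseTableau : ℕ → ℕ → Fin 2 × Fin 3 → Triple
baseTableau m j (ε , δ) = (0 , b , b + suc (toℕ δ + j * 3))
  where b = suc (toℕ ε + m * 2)

baseTableau-B3 : ∀ m j εδ → B3 (baseTableau m j εδ)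
baseTableau-B3 m j (ε , δ) = z<s , m<m+n _ z<s

baseTableau-gaps : ∀ m j ε δ →
  gaps (baseTableau m j (ε , δ)) ≡ (suc (toℕ ε + m * 2) , suc (toℕ δ + j * 3))
baseTableau-gaps m j ε δ = cong (suc (toℕ ε + m * 2) ,_) (m+n∸m≡n (suc (toℕ ε + m * 2)) _)

baseTableau-parity : ∀ m j ε δ → let (_ , b , _) = baseTableau m j (ε , δ) in
                     b % 2 ≡ suc (toℕ ε) % 2
baseTableau-parity m j ε δ = [m+kn]%n≡m%n (suc (toℕ ε)) m 2

baseTableau-gap%3 : ∀ m j ε δ → let (_ , b , a) = baseTableau m j (ε , δ) in
                    (a ∸ b) % 3 ≡ suc (toℕ δ) % 3
baseTableau-gap%3 m j ε δ =
  trans (cong ((_% 3) ∘ proj₂) (baseTableau-gaps m j ε δ)) ([m+kn]%n≡m%n (suc (toℕ δ)) j 3)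

B3⇒shift-baseTableau : ∀ {t} → B3 t →
  ∃[ q ] ∃[ m ] ∃[ j ] ∃[ εδ ] t ≡ shift q (baseTableau m j εδ)
B3⇒shift-baseTableau {c , b , a} (c<b , b<a)
  with m≤n⇒∃[o]m+o≡n c<b | m≤n⇒∃[o]m+o≡n b<a
... | B , refl | D , refl with B divMod 2 | D divMod 3
... | result m ε refl | result j δ refl =
  c , m , j , (ε , δ) ,
  cong₂ _,_ (sym (+-identityʳ c)) (cong₂ _,_ (sym (+-suc c B)) (sym (+-suc-suc c B D)))
  where
  +-suc-suc : ∀ x y z → x + suc (y + suc z) ≡ suc (suc (x + y + z))
  +-suc-suc x y z =
    trans (+-suc x _) (cong suc (trans (sym (+-assoc x y (suc z))) (+-suc (x + y) z)))

-- Initial tableaux are named by v_{t₀}: a − b ≡ 1 (mod 3) for v₀₁₂ and ≡ 0 for v₀₂₁.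
data Kind : Set where
  v₀₁₂ v₀₂₁ : Kind

initialGap : Kind → Fin 3
initialGap v₀₁₂ = 0F
initialGap v₀₂₁ = sucF (sucF 0F)

initialTableau : ℕ → ℕ → Kind → Triple
initialTableau m j κ = baseTableau m j (0F , initialGap κ)

orbit : Kind × Fin 3 → Fin 2 × Fin 3
orbit (v₀₁₂ , 0F)             = 0F , 0F
orbit (v₀₁₂ , sucF 0F)        = 0F , sucF 0F
orbit (v₀₁₂ , sucF (sucF 0F)) = sucF 0F , 0F
orbit (v₀₂₁ , 0F)             = 0F , sucF (sucF 0F)
orbit (v₀₂₁ , sucF 0F)        = sucF 0F , sucF 0F
orbit (v₀₂₁ , sucF (sucF 0F)) = sucF 0F , sucF (sucF 0F)

orbit⁻¹ : Fin 2 × Fin 3 → Kind × Fin 3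
orbit⁻¹ (0F , 0F)                   = v₀₁₂ , 0F
orbit⁻¹ (0F , sucF 0F)              = v₀₁₂ , sucF 0F
orbit⁻¹ (sucF 0F , 0F)              = v₀₁₂ , sucF (sucF 0F)
orbit⁻¹ (0F , sucF (sucF 0F))       = v₀₂₁ , 0F
orbit⁻¹ (sucF 0F , sucF 0F)         = v₀₂₁ , sucF 0F
orbit⁻¹ (sucF 0F , sucF (sucF 0F))  = v₀₂₁ , sucF (sucF 0F)

orbit⁻¹∘orbit : ∀ κr → orbit⁻¹ (orbit κr) ≡ κr
orbit⁻¹∘orbit (v₀₁₂ , 0F)             = refl
orbit⁻¹∘orbit (v₀₁₂ , sucF 0F)        = refl
orbit⁻¹∘orbit (v₀₁₂ , sucF (sucF 0F)) = refl
orbit⁻¹∘orbit (v₀₂₁ , 0F)             = refl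
orbit⁻¹∘orbit (v₀₂₁ , sucF 0F)        = refl
orbit⁻¹∘orbit (v₀₂₁ , sucF (sucF 0F)) = refl

orbit∘orbit⁻¹ : ∀ εδ → orbit (orbit⁻¹ εδ) ≡ εδ
orbit∘orbit⁻¹ (0F , 0F)                  = refl
orbit∘orbit⁻¹ (0F , sucF 0F)             = refl
orbit∘orbit⁻¹ (sucF 0F , 0F)             = refl
orbit∘orbit⁻¹ (0F , sucF (sucF 0F))      = refl
orbit∘orbit⁻¹ (sucF 0F , sucF 0F)        = refl
orbit∘orbit⁻¹ (sucF 0F , sucF (sucF 0F)) = refl

initialTableau-Initial : ∀ m j κ → Initial (initialTableau m j κ)
initialTableau-Initial m j κ =
  baseTableau-B3 m j (0F , initialGap κ) , refl , baseTableau-parity m j 0F (initialGap κ) , gap≢2 κ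
  where
  gap≢2 : ∀ κ → let (_ , b , a) = initialTableau m j κ in (a ∸ b) % 3 ≢ 2
  gap≢2 v₀₁₂ eq with () ← trans (sym (baseTableau-gap%3 m j 0F 0F)) eq
  gap≢2 v₀₂₁ eq with () ← trans (sym (baseTableau-gap%3 m j 0F (sucF (sucF 0F)))) eq

Initial⇒initialTableau : ∀ {t₀} → Initial t₀ → ∃[ m ] ∃[ j ] ∃[ κ ] t₀ ≡ initialTableau m j κ
Initial⇒initialTableau (t₀∈B3 , c≡0 , b-odd , gap≢2) with B3⇒shift-baseTableau t₀∈B3
... | q , m , j , (ε , δ) , refl with m+n≡0⇒m≡0 q c≡0
... | refl with ε | δ
...   | 0F      | 0F               = m , j , v₀₁₂ , refl
...   | 0F      | sucF (sucF 0F)   = m , j , v₀₂₁ , refl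
...   | 0F      | sucF 0F          = ⊥-elim (gap≢2 (baseTableau-gap%3 m j 0F (sucF 0F)))
...   | sucF 0F | _ with () ← trans (sym (baseTableau-parity m j (sucF 0F) δ)) b-odd

module _ {b g : ℕ} where

  stay : (b + 0 , b + g + 0) ≡ (b , b + g)
  stay = cong₂ _,_ (+-identityʳ b) (+-identityʳ (b + g))

  raise-a : (b + 0 , b + g + 1) ≡ (b , b + suc g)
  raise-a = cong₂ _,_ (+-identityʳ b) (trans (+-assoc b g 1) (cong (b +_) (+-comm g 1)))

  raise-b : (b + 1 , b + suc g + 0) ≡ (suc b , suc b + g)
  raise-b = cong₂ _,_ (+-comm b 1) (trans (+-identityʳ _) (+-suc b g))

  raise-b-a : (b + 1 , b + g + 1) ≡ (suc b , suc b + g)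
  raise-b-a = cong₂ _,_ (+-comm b 1) (+-comm (b + g) 1)

step-initialTableau : ∀ m j κ r →
  step (initialTableau m j κ) (toℕ r) ≡ baseTableau m j (orbit (κ , r))
step-initialTableau m j v₀₁₂ r rewrite baseTableau-gap%3 m j 0F 0F with r
... | 0F             = cong (0 ,_) stay
... | sucF 0F        = cong (0 ,_) raise-a
... | sucF (sucF 0F) = cong (0 ,_) raise-b-a
step-initialTableau m j v₀₂₁ r rewrite baseTableau-gap%3 m j 0F (sucF (sucF 0F)) with r
... | 0F             = cong (0 ,_) stay
... | sucF 0F        = cong (0 ,_) raise-b
... | sucF (sucF 0F) = cong (0 ,_) raise-b-a

orbit-initialTableau : ∀ m j κ r q →
  step (initialTableau m j κ) (toℕ r + q * 3) ≡ shift q (baseTableau m j (orbit (κ , r)))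
orbit-initialTableau m j κ r q = begin
  step (initialTableau m j κ) (toℕ r + q * 3)     ≡⟨ step-shift (initialTableau m j κ) (toℕ r) q ⟩
  shift q (step (initialTableau m j κ) (toℕ r))   ≡⟨ cong (shift q) (step-initialTableau m j κ r) ⟩
  shift q (baseTableau m j (orbit (κ , r)))       ∎

gapCoordinates : ℕ × ℕ → ℕ × ℕ × Fin 2 × Fin 3
gapCoordinates (B , D) = (B ∸ 1) div 2 , (D ∸ 1) div 3 , (B ∸ 1) mod 2 , (D ∸ 1) mod 3

gapCoordinates-baseTableau : ∀ m j εδ → gapCoordinates (gaps (baseTableau m j εδ)) ≡ (m , j , εδ)
gapCoordinates-baseTableau m j (ε , δ) = begin
  gapCoordinates (gaps (baseTableau m j (ε , δ)))
    ≡⟨ cong gapCoordinates (baseTableau-gaps m j ε δ) ⟩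
  (toℕ ε + m * 2) div 2 , (toℕ δ + j * 3) div 3 , (toℕ ε + m * 2) mod 2 , (toℕ δ + j * 3) mod 3
    ≡⟨ cong₂ _,_ ([i+kn]div≡k ε m) (cong₂ _,_ ([i+kn]div≡k δ j)
                 (cong₂ _,_ ([i+kn]mod≡i ε m) ([i+kn]mod≡i δ j))) ⟩
  m , j , ε , δ ∎

initialOfCoordinates : ℕ × ℕ × Fin 2 × Fin 3 → Triple
initialOfCoordinates (m , j , εδ) = initialTableau m j (proj₁ (orbit⁻¹ εδ))

initialOf : Triple → Triple
initialOf = initialOfCoordinates ∘ gapCoordinates ∘ gaps

data InOrbit : Triple → Triple → Set where
  shifted : ∀ m j κ r q → InOrbit (initialTableau m j κ) (shift q (baseTableau m j (orbit (κ , r))))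

InP⇒InOrbit : ∀ {t₀ t} → Initial t₀ → InP t₀ t → InOrbit t₀ t
InP⇒InOrbit t₀-initial (k , refl) with Initial⇒initialTableau t₀-initial | k divMod 3
... | m , j , κ , refl | result q r refl =
  subst (InOrbit _) (sym (orbit-initialTableau m j κ r q)) (shifted m j κ r q)

InOrbit⇒InP : ∀ {t₀ t} → InOrbit t₀ t → InP t₀ t
InOrbit⇒InP (shifted m j κ r q) = toℕ r + q * 3 , orbit-initialTableau m j κ r q

InOrbit⇒B3 : ∀ {t₀ t} → InOrbit t₀ t → B3 t
InOrbit⇒B3 (shifted m j κ r q) = B3-shift q (baseTableau-B3 m j (orbit (κ , r)))

initialOf-InOrbit : ∀ {t₀ t} → InOrbit t₀ t → initialOf t ≡ t₀
initialOf-InOrbit (shifted m j κ r q) = begin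
  initialOf (shift q (baseTableau m j (orbit (κ , r))))
    ≡⟨ cong (initialOfCoordinates ∘ gapCoordinates) (gaps-shift q _) ⟩
  initialOf (baseTableau m j (orbit (κ , r)))
    ≡⟨ cong initialOfCoordinates (gapCoordinates-baseTableau m j (orbit (κ , r))) ⟩
  initialTableau m j (proj₁ (orbit⁻¹ (orbit (κ , r))))
    ≡⟨ cong (initialTableau m j ∘ proj₁) (orbit⁻¹∘orbit (κ , r)) ⟩
  initialTableau m j κ ∎

B3⇒InOrbit : ∀ {t} → B3 t → ∃[ t₀ ] (Initial t₀ × InOrbit t₀ t)
B3⇒InOrbit t∈B3 with B3⇒shift-baseTableau t∈B3
... | q , m , j , εδ , refl =
  let (κ , r) = orbit⁻¹ εδ in
  initialTableau m j κ , initialTableau-Initial m j κ ,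
  subst (InOrbit (initialTableau m j κ) ∘ shift q ∘ baseTableau m j) (orbit∘orbit⁻¹ εδ)
        (shifted m j κ r q)

lemma5p2 :
    -- each P(t₀, v_{t₀}) is a subset of 𝓑(3)
    (∀ t₀ t → Initial t₀ → InP t₀ t → B3 t)
    -- the union is all of 𝓑(3)
    × (∀ t → B3 t → ∃[ t₀ ] (Initial t₀ × InP t₀ t))
    -- pairwise disjoint
    × (∀ t₀ t₁ → Initial t₀ → Initial t₁ → t₀ ≢ t₁ → ¬ (∃[ t ] (InP t₀ t × InP t₁ t)))
lemma5p2 =
    (λ _ _ t₀-initial t∈P → InOrbit⇒B3 (InP⇒InOrbit t₀-initial t∈P))
  , (λ _ t∈B3 → map₂ (map₂ InOrbit⇒InP) (B3⇒InOrbit t∈B3))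
  , λ t₀ t₁ t₀-initial t₁-initial t₀≢t₁ (t , t∈P₀ , t∈P₁) → t₀≢t₁ (begin
      t₀          ≡⟨ initialOf-InOrbit (InP⇒InOrbit t₀-initial t∈P₀) ⟨
      initialOf t ≡⟨ initialOf-InOrbit (InP⇒InOrbit t₁-initial t∈P₁) ⟩
      t₁          ∎)
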